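{- If $3\le m\le n$ are integers, then $d_g'(S(P_m\,\square\,P_n))=1$.
   Context: $P_n$ denotes the path on $n$ vertices and $G\,\square\,H$ the Cartesian product (vertex set $V(G)\times V(H)$, two vertices adjacent if equal in one coordinate and adjacent in the other). The subdivision graph $S(G)$ is obtained from $G$ by replacing each edge $uv$ by a new vertex adjacent to exactly $u$ and $v$. For a vertex $x$, $N[x]$ denotes its closed neighborhood. The domatic number game on a graph $H$ with palette $[k]=\{1,\dots,k\}$: two players, Alice and Bob, alternately choose a previously unchosen vertex of $H$ and assign it a color from $[k]$, until every vertex has been colored. Let $V_i$ be the set of vertices colored $i$. Alice wins if every $V_i$ ($i\in[k]$) is a dominating set of $H$, i.e. for every vertex $x$ and every color $c\in[k]$ some vertex of $N[x]$ has color $c$; otherwise Bob wins. In the $B$-game Bob moves first. The delayed game domatic number $d_g'(H)$ is the largest $k$ for which Alice has a winning strategy in the $B$-game with palette $[k]$. -}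

module Defs where

open import Data.Nat using (ℕ; suc; _<_)
open import Data.Fin using (Fin; toℕ)
open import Data.Maybe using (Maybe; just; nothing)
open import Data.Product using (Σ; ∃; _×_; _,_; proj₁; proj₂)
open import Data.Sum using (_⊎_; inj₁; inj₂)
open import Data.Bool using (Bool; true; false)
open import Relation.Binary.PropositionalEquality using (_≡_; _≢_)
open import Relation.Nullary using (¬_)

record Graph : Set₁ where
  field
    V    : Set
    E    : Set
    ends : E → V × V

open Graph public

Adj : (G : Graph) → V G → V G → Set
Adj G u v = ∃ λ e → (ends G e ≡ (u , v)) ⊎ (ends G e ≡ (v , u))

P : ℕ → Graph
P n = record
  { V = Fin n
  ; E = Σ (Fin n × Fin n) (λ p → suc (toℕ (proj₁ p)) ≡ toℕ (proj₂ p))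
  ; ends = proj₁
  }

_□_ : Graph → Graph → Graph
G □ H = record
  { V = V G × V H
  ; E = (V G × E H) ⊎ (E G × V H)
  ; ends = λ { (inj₁ (g , e)) → (g , proj₁ (ends H e)) , (g , proj₂ (ends H e))
             ; (inj₂ (e , h)) → (proj₁ (ends G e) , h) , (proj₂ (ends G e) , h) }
  }

-- Subdivision S(G): each edge e = uv replaced by a new vertex e adjacent to u and v.
S : Graph → Graph
S G = record
  { V = V G ⊎ E G
  ; E = E G × Bool
  ; ends = λ { (e , false) → inj₁ (proj₁ (ends G e)) , inj₂ e
             ; (e , true)  → inj₁ (proj₂ (ends G e)) , inj₂ e }
  }

InClosedNbhd : (G : Graph) → V G → V G → Set
InClosedNbhd G x y = (y ≡ x) ⊎ Adj G x y

Coloring : Graph → ℕ → Set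
Coloring G k = V G → Maybe (Fin k)

Complete : (G : Graph) {k : ℕ} → Coloring G k → Set
Complete G c = ∀ v → ∃ λ i → c v ≡ just i

-- every color class V_j is a dominating set
AliceCondition : (G : Graph) {k : ℕ} → Coloring G k → Set
AliceCondition G {k} c =
  ∀ (j : Fin k) (x : V G) → ∃ λ y → InClosedNbhd G x y × (c y ≡ just j)

Update : (G : Graph) {k : ℕ} → Coloring G k → V G → Fin k → Coloring G k → Set
Update G c v i c' = (c v ≡ nothing) × (c' v ≡ just i) × (∀ w → w ≢ v → c' w ≡ c w)

-- Alice has a winning strategy from position c, with Bob / Alice to move.
data BobToMove (G : Graph) (k : ℕ) : Coloring G k → Set
data AliceToMove (G : Graph) (k : ℕ) : Coloring G k → Set

data BobToMove G k where
  endB  : ∀ {c} → Complete G c → AliceCondition G c → BobToMove G k c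
  stepB : ∀ {c} → (∃ λ v → c v ≡ nothing) →
          (∀ v i c' → Update G c v i c' → AliceToMove G k c') → BobToMove G k c

data AliceToMove G k where
  endA  : ∀ {c} → Complete G c → AliceCondition G c → AliceToMove G k c
  stepA : ∀ {c} v i c' → Update G c v i c' → BobToMove G k c' → AliceToMove G k c

emptyColoring : (G : Graph) (k : ℕ) → Coloring G k
emptyColoring G k _ = nothing

AliceWinsBGame : Graph → ℕ → Set
AliceWinsBGame G k = BobToMove G k (emptyColoring G k)

DelayedGameDomaticNumberIs : Graph → ℕ → Set
DelayedGameDomaticNumberIs G d = AliceWinsBGame G d × (∀ k → d < k → ¬ AliceWinsBGame G k)

{-# OPTIONS --safe #-}
-- With a single colour every complete colouring is winning, so on a finite graph Alice wins by
-- colouring anything until the board is full.  With two or more colours, among them A ≠ B, Bob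
-- targets a subdivision vertex e of an edge pq: N[e] = {e, p, q}, so once these three carry
-- colours other than B, the class of B no longer dominates e.  Bob colours the grid vertex (1,1)
-- with A.  Two 4-cycles pass through (1,1) and share nothing else, so Alice's reply misses one of
-- them, and Bob walks around it colouring grid vertices A.  Each new vertex threatens the
-- subdivision vertex of the edge just walked, which Alice must colour B at once; the last vertex
-- closes the cycle and creates two threats, and Alice can only answer one.
module Submission where

open import Defs
open import Data.Nat using (ℕ; suc; _+_; _≤_; _<_; z≤n; s≤s)
import Data.Nat.Properties as ℕ
open import Data.Fin as Fin using (Fin; toℕ)
open import Data.Maybe using (Maybe; just; nothing)
open import Data.Product using (Σ; ∃; _×_; _,_; proj₁; proj₂)
open import Data.Product.Properties using () renaming (≡-dec to Σ-≡-dec)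
open import Data.Sum as Sum using (_⊎_; inj₁; inj₂)
open import Data.Sum.Properties using () renaming (≡-dec to ⊎-≡-dec)
open import Data.Bool using (true; false)
open import Data.Empty using (⊥-elim)
open import Data.List using (List; []; _∷_; _++_; map; cartesianProduct; allFin)
open import Data.List.Membership.Propositional using (_∈_; _∉_)
open import Data.List.Membership.Propositional.Properties
  using (∈-allFin; ∈-cartesianProduct⁺; ∈-++⁺ˡ; ∈-++⁺ʳ; ∈-map⁺)
open import Data.List.Relation.Unary.Any using (here; there)
open import Data.List.Relation.Unary.All as All using (All; []; _∷_)
open import Data.List.Relation.Unary.All.Properties using (¬Any⇒All¬)
open import Data.List.Relation.Unary.AllPairs using (_∷_)
open import Data.List.Relation.Unary.Unique.Propositional using (Unique)
open import Data.List.Relation.Unary.Unique.Propositional.Properties using (drop⁺)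
open import Data.List.Relation.Unary.Unique.DecPropositional using (unique?)
open import Data.List.Relation.Binary.Disjoint.Propositional using (Disjoint)
open import Data.List.Relation.Binary.Disjoint.DecPropositional using (disjoint?)
open import Relation.Binary.Definitions using (DecidableEquality)
open import Relation.Binary.PropositionalEquality using (_≡_; _≢_; refl; sym; trans; cong)
open import Relation.Nullary using (¬_; yes; no)
open import Relation.Nullary.Decidable using (from-yes)
open import Relation.Unary using (Decidable; Irrelevant)
open import Function using (_∘_)

private
  variable
    k : ℕ

module Positions (G : Graph) where

  Uncoloured : Coloring G k → List (V G) → Set
  Uncoloured c = All (λ y → c y ≡ nothing)

  Extends : Coloring G k → Coloring G k → Set
  Extends c c′ = ∀ {y j} → c y ≡ just j → c′ y ≡ just j

  complete⇒coloured : {c : Coloring G k} → Complete G c → ∀ {y} → c y ≢ nothing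
  complete⇒coloured done {y} cy with () ← trans (sym cy) (proj₂ (done y))

  module _ {c c′ : Coloring G k} {v : V G} {i : Fin k} (u : Update G c v i c′) where

    update-paints : c′ v ≡ just i
    update-paints = proj₁ (proj₂ u)

    update-extends : Extends c c′
    update-extends {y} cy = trans (proj₂ (proj₂ u) y y≢v) cy
      where
      y≢v : y ≢ v
      y≢v refl with () ← trans (sym (proj₁ u)) cy

    update-keeps-nothing : ∀ {y} → v ≢ y → c y ≡ nothing → c′ y ≡ nothing
    update-keeps-nothing {y} v≢y = trans (proj₂ (proj₂ u) y (v≢y ∘ sym))

    update-keeps-uncoloured : ∀ {ys} → All (v ≢_) ys → Uncoloured c ys → Uncoloured c′ ys
    update-keeps-uncoloured v≢ys unc =
      All.zipWith (λ (v≢y , cy) → update-keeps-nothing v≢y cy) (v≢ys , unc)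

  ColouredOtherThan : Coloring G k → Fin k → V G → Set
  ColouredOtherThan c j y = ∃ λ i → c y ≡ just i × i ≢ j

  Blocked : Coloring G k → Fin k → V G → Set
  Blocked c j x = ∀ {y} → InClosedNbhd G x y → ColouredOtherThan c j y

  blocked-extends : {c c′ : Coloring G k} {j : Fin k} {x : V G} →
                    Extends c c′ → Blocked c j x → Blocked c′ j x
  blocked-extends c⊑c′ blocked y∈N with i , cy , i≢j ← blocked y∈N = i , c⊑c′ cy , i≢j

  blocked⇒¬AliceCondition : {c : Coloring G k} {j : Fin k} {x : V G} →
                            Blocked c j x → ¬ AliceCondition G c
  blocked⇒¬AliceCondition {j = j} {x} blocked dominating
    with y , y∈N , cy ← dominating j x
    with i , cy′ , i≢j ← blocked y∈N
    with refl ← trans (sym cy′) cy = i≢j refl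

  module Moves (_≟_ : DecidableEquality (V G)) {k : ℕ} where

    paint : Coloring G k → V G → Fin k → Coloring G k
    paint c v i y with y ≟ v
    ... | yes _ = just i
    ... | no _  = c y

    paint-update : {c : Coloring G k} {v : V G} {i : Fin k} →
                   c v ≡ nothing → Update G c v i (paint c v i)
    paint-update {c} {v} {i} cv = cv , painted , unchanged
      where
      painted : paint c v i v ≡ just i
      painted with v ≟ v
      ... | yes _   = refl
      ... | no v≢v = ⊥-elim (v≢v refl)
      unchanged : ∀ y → y ≢ v → paint c v i y ≡ c y
      unchanged y y≢v with y ≟ v
      ... | yes y≡v = ⊥-elim (y≢v y≡v)
      ... | no _    = refl

    bob-plays : {c : Coloring G k} {v : V G} (i : Fin k) → c v ≡ nothing →
                ¬ AliceToMove G k (paint c v i) → ¬ BobToMove G k c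
    bob-plays i cv _    (endB done _)  = complete⇒coloured done cv
    bob-plays i cv lose (stepB _ next) = lose (next _ i _ (paint-update cv))

    alice-must-play : {c : Coloring G k} {y : V G} → c y ≡ nothing →
                      (∀ {a i c′} → Update G c a i c′ → ¬ BobToMove G k c′) →
                      ¬ AliceToMove G k c
    alice-must-play cy _    (endA done _)        = complete⇒coloured done cy
    alice-must-play cy lose (stepA _ _ _ u next) = lose u next

    blocked⇒¬BobToMove   : {c : Coloring G k} {j : Fin k} {x : V G} →
                           Blocked c j x → ¬ BobToMove G k c
    blocked⇒¬AliceToMove : {c : Coloring G k} {j : Fin k} {x : V G} →
                           Blocked c j x → ¬ AliceToMove G k c

    blocked⇒¬BobToMove b (endB _ dominating) = blocked⇒¬AliceCondition b dominating
    blocked⇒¬BobToMove {j = j} b (stepB (v , cv) next) =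
      blocked⇒¬AliceToMove (blocked-extends (update-extends u) b) (next v j _ u)
      where u = paint-update cv
    blocked⇒¬AliceToMove b (endA _ dominating) = blocked⇒¬AliceCondition b dominating
    blocked⇒¬AliceToMove b (stepA _ _ _ u next) =
      blocked⇒¬BobToMove (blocked-extends (update-extends u) b) next

  singleton-palette-wins : {c : Coloring G 1} → Complete G c → AliceCondition G c
  singleton-palette-wins done Fin.zero x with done x
  ... | Fin.zero , cx = x , inj₁ refl , cx

module Finite {G : Graph} (_≟_ : DecidableEquality (V G))
              (xs : List (V G)) (enumerates : ∀ v → v ∈ xs) where

  open Positions G
  open Moves _≟_

  pending : Maybe (Fin k) → ℕ
  pending nothing  = 1
  pending (just _) = 0

  uncolouredCount : Coloring G k → List (V G) → ℕ
  uncolouredCount c []       = 0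
  uncolouredCount c (y ∷ ys) = pending (c y) + uncolouredCount c ys

  module _ {c c′ : Coloring G k} {v : V G} {i : Fin k} (u : Update G c v i c′) where

    update-pending-≤ : ∀ y → pending (c′ y) ≤ pending (c y)
    update-pending-≤ y with c y in cy
    ... | just _ rewrite update-extends u cy = z≤n
    ... | nothing with c′ y
    ...   | nothing = ℕ.≤-refl
    ...   | just _  = z≤n

    update-pending-< : pending (c′ v) < pending (c v)
    update-pending-< rewrite proj₁ u | update-paints u = s≤s z≤n

    update-count-≤ : ∀ ys → uncolouredCount c′ ys ≤ uncolouredCount c ys
    update-count-≤ []       = z≤n
    update-count-≤ (y ∷ ys) = ℕ.+-mono-≤ (update-pending-≤ y) (update-count-≤ ys)

    update-count-< : ∀ {ys} → v ∈ ys → uncolouredCount c′ ys < uncolouredCount c ys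
    update-count-< {y ∷ ys} (here refl) = ℕ.+-mono-<-≤ update-pending-< (update-count-≤ ys)
    update-count-< {y ∷ ys} (there v∈ys) = ℕ.+-mono-≤-< (update-pending-≤ y) (update-count-< v∈ys)

  uncoloured-or-complete : (c : Coloring G k) → (∃ λ y → c y ≡ nothing) ⊎ Complete G c
  uncoloured-or-complete c = Sum.map₂ (λ coloured v → All.lookup coloured (enumerates v)) (scan xs)
    where
    scan : ∀ ys → (∃ λ y → c y ≡ nothing) ⊎ All (λ y → ∃ λ i → c y ≡ just i) ys
    scan []       = inj₂ []
    scan (y ∷ ys) with c y in cy
    ... | nothing = inj₁ (y , cy)
    ... | just i  = Sum.map₂ ((i , cy) ∷_) (scan ys)

  module _ (complete-wins : {c : Coloring G (suc k)} → Complete G c → AliceCondition G c) where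

    alice-wins-within : ∀ fuel (c : Coloring G (suc k)) → uncolouredCount c xs < fuel →
                        BobToMove G (suc k) c × AliceToMove G (suc k) c
    alice-wins-within (suc fuel) c bound with uncoloured-or-complete c
    ... | inj₂ done = endB done (complete-wins done) , endA done (complete-wins done)
    ... | inj₁ (y , cy) =
      stepB (y , cy) (λ _ _ _ u → proj₂ (alice-wins-within fuel _ (shrinks u))) ,
      stepA y Fin.zero _ alice-move (proj₁ (alice-wins-within fuel _ (shrinks alice-move)))
      where
      alice-move = paint-update cy
      shrinks : ∀ {v i c′} → Update G c v i c′ → uncolouredCount c′ xs < fuel
      shrinks {v} u = ℕ.<-≤-trans (update-count-< u (enumerates v)) (ℕ.≤-pred bound)

    complete-wins⇒AliceWinsBGame : AliceWinsBGame G (suc k)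
    complete-wins⇒AliceWinsBGame = proj₁ (alice-wins-within _ (emptyColoring G (suc k)) (ℕ.n<1+n _))

  aliceWinsBGame-1 : AliceWinsBGame G 1
  aliceWinsBGame-1 = complete-wins⇒AliceWinsBGame singleton-palette-wins

Joins : (G : Graph) → E G → V G → V G → Set
Joins G e a b = ends G e ≡ (a , b) ⊎ ends G e ≡ (b , a)

subdivision-blocked : {G : Graph} {c : Coloring (S G) k} {j : Fin k} {e : E G} →
  let open Positions (S G) in
  ColouredOtherThan c j (inj₂ e) →
  ColouredOtherThan c j (inj₁ (proj₁ (ends G e))) →
  ColouredOtherThan c j (inj₁ (proj₂ (ends G e))) →
  Blocked c j (inj₂ e)
subdivision-blocked ce c₁ c₂ (inj₁ refl)                        = ce
subdivision-blocked ce c₁ c₂ (inj₂ ((_ , false) , inj₂ refl)) = c₁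
subdivision-blocked ce c₁ c₂ (inj₂ ((_ , true)  , inj₂ refl)) = c₂

record FourCycleAt (G : Graph) (u : V G) : Set where
  field
    v w x : V G
    e₁ e₂ e₃ e₄ : E G
    e₁-joins : Joins G e₁ u v
    e₂-joins : Joins G e₂ v w
    e₃-joins : Joins G e₃ w x
    e₄-joins : Joins G e₄ x u

  -- listed in the order in which Bob's walk gets them coloured, so the distinctness each move
  -- needs is the head of a `Unique` proof
  rim : List (V (S G))
  rim = inj₁ v ∷ inj₂ e₁ ∷ inj₁ w ∷ inj₂ e₂ ∷ inj₁ x ∷ inj₂ e₃ ∷ inj₂ e₄ ∷ []

module TwoColours {G : Graph} (_≟_ : DecidableEquality (V (S G))) (k : ℕ) where

  open Positions (S G)
  open Moves _≟_ {2 + k}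
  open FourCycleAt

  A B : Fin (2 + k)
  A = Fin.zero
  B = Fin.suc Fin.zero

  A≢B : A ≢ B
  A≢B ()

  record Threat (c : Coloring (S G) (2 + k)) (e : E G) : Set where
    field
      midpoint-uncoloured : c (inj₂ e) ≡ nothing
      end₁-A : c (inj₁ (proj₁ (ends G e))) ≡ just A
      end₂-A : c (inj₁ (proj₂ (ends G e))) ≡ just A

  threat : {c : Coloring (S G) (2 + k)} {e : E G} {a b : V G} → Joins G e a b →
           c (inj₁ a) ≡ just A → c (inj₁ b) ≡ just A → c (inj₂ e) ≡ nothing → Threat c e
  threat (inj₁ refl) ca cb ce = record { midpoint-uncoloured = ce ; end₁-A = ca ; end₂-A = cb }
  threat (inj₂ refl) ca cb ce = record { midpoint-uncoloured = ce ; end₁-A = cb ; end₂-A = ca }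

  threat-survives : {c c′ : Coloring (S G) (2 + k)} {e : E G} {a : V (S G)} {i : Fin (2 + k)} →
                    Update (S G) c a i c′ → a ≢ inj₂ e → Threat c e → Threat c′ e
  threat-survives u a≢e t = record
    { midpoint-uncoloured = update-keeps-nothing u a≢e midpoint-uncoloured
    ; end₁-A = update-extends u end₁-A
    ; end₂-A = update-extends u end₂-A
    }
    where open Threat t

  threat-blocked : {c c′ : Coloring (S G) (2 + k)} {e : E G} {i : Fin (2 + k)} →
                   Update (S G) c (inj₂ e) i c′ → i ≢ B → Threat c e → Blocked c′ B (inj₂ e)
  threat-blocked {c′ = c′} u i≢B t =
    subdivision-blocked {c = c′} (_ , update-paints u , i≢B)
      (A , update-extends u end₁-A , A≢B) (A , update-extends u end₂-A , A≢B)
    where open Threat t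

  threat⇒¬BobToMove : {c : Coloring (S G) (2 + k)} {e : E G} →
                      Threat c e → ¬ BobToMove (S G) (2 + k) c
  threat⇒¬BobToMove t =
    bob-plays A ce (blocked⇒¬AliceToMove (threat-blocked u A≢B t))
    where
    ce = Threat.midpoint-uncoloured t
    u = paint-update ce

  threat-forces-B : {c : Coloring (S G) (2 + k)} {e : E G} → Threat c e →
                    (∀ {c′} → Update (S G) c (inj₂ e) B c′ → ¬ BobToMove (S G) (2 + k) c′) →
                    ¬ AliceToMove (S G) (2 + k) c
  threat-forces-B {e = e} t after-B = alice-must-play (Threat.midpoint-uncoloured t) response
    where
    response : ∀ {a i c′} → Update (S G) _ a i c′ → ¬ BobToMove (S G) (2 + k) c′
    response {a} {i} u with a ≟ inj₂ e
    ... | no a≢e = threat⇒¬BobToMove (threat-survives u a≢e t)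
    ... | yes refl with i Fin.≟ B
    ...   | yes refl = after-B u
    ...   | no i≢B   = blocked⇒¬BobToMove (threat-blocked u i≢B t)

  two-threats⇒¬AliceToMove : {c : Coloring (S G) (2 + k)} {e e′ : E G} →
                             inj₂ e ≢ inj₂ e′ → Threat c e → Threat c e′ →
                             ¬ AliceToMove (S G) (2 + k) c
  two-threats⇒¬AliceToMove e≢e′ t t′ =
    threat-forces-B t (λ u → threat⇒¬BobToMove (threat-survives u e≢e′ t′))

  paint-edge-forcing-B :
    {c : Coloring (S G) (2 + k)} {e : E G} {q p : V G} {rest : List (V (S G))} →
    Joins G e q p → c (inj₁ q) ≡ just A →
    Unique (inj₁ p ∷ inj₂ e ∷ rest) → Uncoloured c (inj₁ p ∷ inj₂ e ∷ rest) →
    (∀ {c′} → Extends c c′ → c′ (inj₁ p) ≡ just A → Uncoloured c′ rest →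
              ¬ BobToMove (S G) (2 + k) c′) →
    ¬ BobToMove (S G) (2 + k) c
  paint-edge-forcing-B e-joins cq ((p≢e ∷ p≢rest) ∷ (e≢rest ∷ _)) (cp ∷ ce ∷ crest) continue =
    bob-plays A cp (threat-forces-B
      (threat e-joins (update-extends u₁ cq) (update-paints u₁) (update-keeps-nothing u₁ p≢e ce))
      λ u₂ → continue (update-extends u₂ ∘ update-extends u₁)
                      (update-extends u₂ (update-paints u₁))
                      (update-keeps-uncoloured u₂ e≢rest (update-keeps-uncoloured u₁ p≢rest crest)))
    where u₁ = paint-update cp

  paint-closing-vertex :
    {c : Coloring (S G) (2 + k)} {e e′ : E G} {q p r : V G} →
    Joins G e q p → Joins G e′ p r → c (inj₁ q) ≡ just A → c (inj₁ r) ≡ just A →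
    Unique (inj₁ p ∷ inj₂ e ∷ inj₂ e′ ∷ []) → Uncoloured c (inj₁ p ∷ inj₂ e ∷ inj₂ e′ ∷ []) →
    ¬ BobToMove (S G) (2 + k) c
  paint-closing-vertex e-joins e′-joins cq cr
                       ((p≢e ∷ p≢e′ ∷ []) ∷ (e≢e′ ∷ []) ∷ _) (cp ∷ ce ∷ ce′ ∷ []) =
    bob-plays A cp (two-threats⇒¬AliceToMove e≢e′
      (threat e-joins (update-extends u cq) (update-paints u) (update-keeps-nothing u p≢e ce))
      (threat e′-joins (update-paints u) (update-extends u cr) (update-keeps-nothing u p≢e′ ce′)))
    where u = paint-update cp

  fourCycle-wins : {c : Coloring (S G) (2 + k)} {u : V G} (C : FourCycleAt G u) →
                   Unique (inj₁ u ∷ rim C) →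
                   c (inj₁ u) ≡ just A → Uncoloured c (rim C) → ¬ BobToMove (S G) (2 + k) c
  fourCycle-wins C distinct cu unc =
    paint-edge-forcing-B (e₁-joins C) cu (drop⁺ 1 distinct) unc λ ext₁ cv unc₁ →
    paint-edge-forcing-B (e₂-joins C) cv (drop⁺ 3 distinct) unc₁ λ ext₂ cw unc₂ →
    paint-closing-vertex (e₃-joins C) (e₄-joins C) cw (ext₂ (ext₁ cu)) (drop⁺ 5 distinct) unc₂

  two-fourCycles⇒¬AliceWinsBGame :
    (u : V G) (C C′ : FourCycleAt G u) →
    Unique (inj₁ u ∷ rim C) → Unique (inj₁ u ∷ rim C′) → Disjoint (rim C) (rim C′) →
    ¬ AliceWinsBGame (S G) (2 + k)
  two-fourCycles⇒¬AliceWinsBGame u C C′ distinct distinct′ disjoint =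
    bob-plays A refl (alice-must-play (All.head (start C distinct)) response)
    where
    open import Data.List.Membership.DecPropositional _≟_ using (_∈?_)
    u₀ = paint-update {c = emptyColoring (S G) (2 + k)} {v = inj₁ u} {i = A} refl
    start : (D : FourCycleAt G u) → Unique (inj₁ u ∷ rim D) →
            Uncoloured (paint (emptyColoring (S G) (2 + k)) (inj₁ u) A) (rim D)
    start D (u≢rim ∷ _) = update-keeps-uncoloured u₀ u≢rim (All.universal (λ _ → refl) _)
    play-on : ∀ {a i c′} (D : FourCycleAt G u) → Unique (inj₁ u ∷ rim D) → a ∉ rim D →
              Update (S G) (paint (emptyColoring (S G) (2 + k)) (inj₁ u) A) a i c′ →
              ¬ BobToMove (S G) (2 + k) c′
    play-on D distinctD a∉D u₁ =
      fourCycle-wins D distinctD (update-extends u₁ (update-paints u₀))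
                     (update-keeps-uncoloured u₁ (¬Any⇒All¬ _ a∉D) (start D distinctD))
    response : ∀ {a i c′} → Update (S G) _ a i c′ → ¬ BobToMove (S G) (2 + k) c′
    response {a} u₁ with a ∈? rim C
    ... | no a∉C  = play-on C distinct a∉C u₁
    ... | yes a∈C = play-on C′ distinct′ (λ a∈C′ → disjoint (a∈C , a∈C′)) u₁

module _ {A B : Set} {xs : List A} {ys : List B} where

  ×-enumerates : (∀ a → a ∈ xs) → (∀ b → b ∈ ys) → ∀ p → p ∈ cartesianProduct xs ys
  ×-enumerates all-xs all-ys (a , b) = ∈-cartesianProduct⁺ (all-xs a) (all-ys b)

  ⊎-enumerates : (∀ a → a ∈ xs) → (∀ b → b ∈ ys) → ∀ s → s ∈ map inj₁ xs ++ map inj₂ ys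
  ⊎-enumerates all-xs all-ys (inj₁ a) = ∈-++⁺ˡ (∈-map⁺ inj₁ (all-xs a))
  ⊎-enumerates all-xs all-ys (inj₂ b) = ∈-++⁺ʳ (map inj₁ xs) (∈-map⁺ inj₂ (all-ys b))

module _ {A : Set} {P : A → Set} (P? : Decidable P) where

  satisfying : List A → List (Σ A P)
  satisfying []       = []
  satisfying (a ∷ as) with P? a
  ... | yes pa = (a , pa) ∷ satisfying as
  ... | no _   = satisfying as

  ∈-satisfying : Irrelevant P → ∀ {a as} (pa : P a) → a ∈ as → (a , pa) ∈ satisfying as
  ∈-satisfying irr {a} {a ∷ as} pa (here refl) with P? a
  ... | yes pa′ = here (cong (a ,_) (irr pa pa′))
  ... | no ¬pa  = ⊥-elim (¬pa pa)
  ∈-satisfying irr {as = b ∷ as} pa (there a∈as) with P? b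
  ... | yes _ = there (∈-satisfying irr pa a∈as)
  ... | no _  = ∈-satisfying irr pa a∈as

pathEdges : ∀ n → List (E (P n))
pathEdges n =
  satisfying (λ (i , j) → suc (toℕ i) ℕ.≟ toℕ j) (cartesianProduct (allFin n) (allFin n))

pathEdges-enumerates : ∀ n (e : E (P n)) → e ∈ pathEdges n
pathEdges-enumerates n (ij , step) =
  ∈-satisfying _ ℕ.≡-irrelevant step (×-enumerates ∈-allFin ∈-allFin ij)

pathEdge-≟ : ∀ {n} → DecidableEquality (E (P n))
pathEdge-≟ = Σ-≡-dec (Σ-≡-dec Fin._≟_ Fin._≟_) (λ p q → yes (ℕ.≡-irrelevant p q))

module SubdividedGrid (m n : ℕ) where

  Grid : Graph
  Grid = P m □ P n

  vertex-≟ : DecidableEquality (V (S Grid))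
  vertex-≟ = ⊎-≡-dec (Σ-≡-dec Fin._≟_ Fin._≟_)
                       (⊎-≡-dec (Σ-≡-dec Fin._≟_ pathEdge-≟) (Σ-≡-dec pathEdge-≟ Fin._≟_))

  vertices : List (V (S Grid))
  vertices = map inj₁ (cartesianProduct (allFin m) (allFin n))
          ++ map inj₂ (map inj₁ (cartesianProduct (allFin m) (pathEdges n))
                    ++ map inj₂ (cartesianProduct (pathEdges m) (allFin n)))

  vertices-enumerate : ∀ v → v ∈ vertices
  vertices-enumerate =
    ⊎-enumerates (×-enumerates ∈-allFin ∈-allFin)
                 (⊎-enumerates (×-enumerates ∈-allFin (pathEdges-enumerates n))
                               (×-enumerates (pathEdges-enumerates m) ∈-allFin))

module LargeGrid (m n : ℕ) where

  open SubdividedGrid (3 + m) (3 + n)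

  #0 #1 #2 : ∀ {r} → Fin (3 + r)
  #0 = Fin.zero
  #1 = Fin.suc Fin.zero
  #2 = Fin.suc (Fin.suc Fin.zero)

  #0-#1 #1-#2 : ∀ {r} → E (P (3 + r))
  #0-#1 = (#0 , #1) , refl
  #1-#2 = (#1 , #2) , refl

  centre : V Grid
  centre = #1 , #1

  lowerCycle upperCycle : FourCycleAt Grid centre
  lowerCycle = record
    { v = #0 , #1 ; w = #0 , #0 ; x = #1 , #0
    ; e₁ = inj₂ (#0-#1 , #1) ; e₂ = inj₁ (#0 , #0-#1)
    ; e₃ = inj₂ (#0-#1 , #0) ; e₄ = inj₁ (#1 , #0-#1)
    ; e₁-joins = inj₂ refl ; e₂-joins = inj₂ refl ; e₃-joins = inj₁ refl ; e₄-joins = inj₁ refl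
    }
  upperCycle = record
    { v = #2 , #1 ; w = #2 , #2 ; x = #1 , #2
    ; e₁ = inj₂ (#1-#2 , #1) ; e₂ = inj₁ (#2 , #1-#2)
    ; e₃ = inj₂ (#1-#2 , #2) ; e₄ = inj₁ (#1 , #1-#2)
    ; e₁-joins = inj₁ refl ; e₂-joins = inj₁ refl ; e₃-joins = inj₂ refl ; e₄-joins = inj₂ refl
    }

  open FourCycleAt using (rim)

  bob-wins : ∀ k → ¬ AliceWinsBGame (S Grid) (2 + k)
  bob-wins k = TwoColours.two-fourCycles⇒¬AliceWinsBGame vertex-≟ k centre lowerCycle upperCycle
    (from-yes (unique? vertex-≟ (inj₁ centre ∷ rim lowerCycle)))
    (from-yes (unique? vertex-≟ (inj₁ centre ∷ rim upperCycle)))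
    (from-yes (disjoint? vertex-≟ (rim lowerCycle) (rim upperCycle)))

corollary5p7 : (m n : ℕ) → 3 ≤ m → m ≤ n →
    DelayedGameDomaticNumberIs (S (P m □ P n)) 1
corollary5p7 (suc (suc (suc m))) (suc (suc (suc n))) (s≤s (s≤s (s≤s _))) (s≤s (s≤s (s≤s _))) =
  Finite.aliceWinsBGame-1 vertex-≟ vertices vertices-enumerate , bob-wins-from-2
  where
  open SubdividedGrid (3 + m) (3 + n)
  bob-wins-from-2 : ∀ k → 1 < k → ¬ AliceWinsBGame (S Grid) k
  bob-wins-from-2 (suc (suc k)) (s≤s (s≤s z≤n)) = LargeGrid.bob-wins m n k
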